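{- Let $A$ be an $r\times n$ integer matrix with columns $C_1,\dots,C_n$ and first-row entries $a_{11}>0$, $a_{12}<0$. Let $A_1=(C_1,C_1+C_2,C_3,\dots,C_n)$, $A_2=(C_1+C_2,C_2,C_3,\dots,C_n)$, $A_3=(C_1+C_2,C_3,\dots,C_n)$, and let $\bar E_i$ be the set of vectors with all entries positive integers solving $A_i\alpha=\mathbf{0}$. If $\bar E_1,\bar E_2,\bar E_3$ are all nonempty, then $\mathrm{rank}(A_3)=\mathrm{rank}(A)$. -}

module Defs where

open import Data.Nat using (ℕ; zero; suc)
open import Data.Fin using (Fin; zero; suc)
open import Data.Integer as ℤ using (ℤ)
open import Data.Rational as ℚ using (ℚ)
open import Data.Product using (Σ; _×_; ∃)
open import Function.Definitions using (Injective)
open import Relation.Binary.PropositionalEquality using (_≡_)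
open import Relation.Nullary using (¬_)

Matrix : ℕ → ℕ → Set
Matrix r n = Fin r → Fin n → ℤ

Σℤ : ∀ {n} → (Fin n → ℤ) → ℤ
Σℤ {zero}  f = ℤ.0ℤ
Σℤ {suc n} f = f zero ℤ.+ Σℤ (λ j → f (suc j))

Σℚ : ∀ {n} → (Fin n → ℚ) → ℚ
Σℚ {zero}  f = ℚ.0ℚ
Σℚ {suc n} f = f zero ℚ.+ Σℚ (λ j → f (suc j))

toℚ : ℤ → ℚ
toℚ z = z ℚ./ 1

ColumnsIndependent : ∀ {r n k} → Matrix r n → (Fin k → Fin n) → Set
ColumnsIndependent {r} {n} {k} A f =
  (c : Fin k → ℚ) →
  (∀ (i : Fin r) → Σℚ (λ j → c j ℚ.* toℚ (A i (f j))) ≡ ℚ.0ℚ) →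
  ∀ (j : Fin k) → c j ≡ ℚ.0ℚ

IsRank : ∀ {r n} → Matrix r n → ℕ → Set
IsRank {r} {n} A k =
  (Σ (Fin k → Fin n) λ f → Injective _≡_ _≡_ f × ColumnsIndependent A f)
  × (∀ (f : Fin (suc k) → Fin n) → Injective _≡_ _≡_ f → ¬ ColumnsIndependent A f)

HasPositiveSolution : ∀ {r n} → Matrix r n → Set
HasPositiveSolution {r} {n} A =
  Σ (Fin n → ℤ) λ α → (∀ j → ℤ.0ℤ ℤ.< α j) × (∀ i → Σℤ (λ j → A i j ℤ.* α j) ≡ ℤ.0ℤ)

A₁ : ∀ {r m} → Matrix r (suc (suc m)) → Matrix r (suc (suc m))
A₁ A i zero          = A i zero
A₁ A i (suc zero)    = A i zero ℤ.+ A i (suc zero)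
A₁ A i (suc (suc j)) = A i (suc (suc j))

A₂ : ∀ {r m} → Matrix r (suc (suc m)) → Matrix r (suc (suc m))
A₂ A i zero          = A i zero ℤ.+ A i (suc zero)
A₂ A i (suc zero)    = A i (suc zero)
A₂ A i (suc (suc j)) = A i (suc (suc j))

A₃ : ∀ {r m} → Matrix r (suc (suc m)) → Matrix r (suc m)
A₃ A i zero    = A i zero ℤ.+ A i (suc zero)
A₃ A i (suc j) = A i (suc (suc j))

-- A positive solution α of A₁ is a linear relation
--   α₁ C₁ + α₂ (C₁ + C₂) + α₃ C₃ + ⋯ + αₙ Cₙ = 0
-- with α₁ ≠ 0, so C₁ lies in the column span of A₃; likewise a positive solution of A₂
-- puts C₂ there. Hence A and A₃ have the same column span. Rank, defined as the largest
-- number of independent columns, only depends on the span by the Steinitz exchange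
-- lemma, which follows from Gaussian elimination over ℚ.
module Submission where

open import Algebra.Bundles using (CommutativeRing)
open import Data.Fin using (Fin; zero; suc; punchIn; _≟_)
open import Data.Fin.Properties using (all?; ¬∀⟶∃¬; suc-injective; punchIn-injective; punchIn-punchOut)
open import Data.Integer as ℤ using (ℤ; 0ℤ; _<_)
import Data.Integer.Properties as ℤ
open import Data.Nat using (ℕ; zero; suc; _≤_; _≤‴_; z≤n; s≤s; ≤‴-refl; ≤‴-step)
open import Data.Nat.Properties using (m≤n⇒m≤1+n; ≤⇒≤‴)
open import Data.Product as Product using (∃; _×_; _,_)
open import Data.Rational as ℚ using (ℚ; 0ℚ; 1ℚ; _+_; _-_; _*_; -_; 1/_; NonZero; ≢-nonZero)
import Data.Rational.Properties as ℚ
open import Data.Rational.Unnormalised as ℚᵘ using (mkℚᵘ; *≡*) renaming (_≃_ to _≃ᵘ_)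
import Data.Rational.Unnormalised.Properties as ℚᵘ
open import Data.Sum as Sum using (_⊎_; inj₁; inj₂)
open import Data.Vec.Functional using (Vector; removeAt; insertAt)
open import Data.Vec.Functional.Properties using (insertAt-lookup; insertAt-punchIn; removeAt-insertAt; removeAt-punchOut)
open import Function using (_∘_; id; const; _⇔_; mk⇔; Equivalence)
open import Function.Definitions using (Injective)
open import Level using (0ℓ)
open import Relation.Binary.PropositionalEquality
open import Relation.Nullary using (¬_; yes; no; contradiction)
open import Relation.Nullary.Decidable using (dec⇒maybe)
open import Tactic.RingSolver using (solve-∀)
open import Tactic.RingSolver.Core.AlmostCommutativeRing using (AlmostCommutativeRing; fromCommutativeRing)

open import Algebra.Properties.Semiring.Sum (CommutativeRing.semiring ℚ.+-*-commutativeRing)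
  using (sum; sum-cong-≗; sum-replicate-zero; sum-remove; ∑-distrib-+; ∑-comm; *-distribˡ-sum; *-distribʳ-sum)

open import Defs

ℚ-ring : AlmostCommutativeRing 0ℓ 0ℓ
ℚ-ring = fromCommutativeRing ℚ.+-*-commutativeRing (λ x → dec⇒maybe (0ℚ ℚ.≟ x))

x*a+y≡0⇒x≡-[y*1/a] : ∀ {x y} a .{{_ : NonZero a}} → x * a + y ≡ 0ℚ → x ≡ - (y * 1/ a)
x*a+y≡0⇒x≡-[y*1/a] {x} {y} a x*a+y≡0 = begin
  x                            ≡⟨ ℚ.*-identityʳ x ⟨
  x * 1ℚ                       ≡⟨ cong (x *_) (ℚ.*-inverseʳ a) ⟨
  x * (a * 1/ a)               ≡⟨ regroup x a (1/ a) y ⟩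
  (x * a + y) * 1/ a - y * 1/ a ≡⟨ cong (λ t → t * 1/ a - y * 1/ a) x*a+y≡0 ⟩
  0ℚ * 1/ a - y * 1/ a         ≡⟨ cong (_- y * 1/ a) (ℚ.*-zeroˡ (1/ a)) ⟩
  0ℚ - y * 1/ a                ≡⟨ ℚ.+-identityˡ _ ⟩
  - (y * 1/ a)                 ∎
  where
  open ≡-Reasoning
  regroup : ∀ x a b y → x * (a * b) ≡ (x * a + y) * b - y * b
  regroup = solve-∀ ℚ-ring

-[y*1/a]*a+y≡0 : ∀ y a .{{_ : NonZero a}} → - (y * 1/ a) * a + y ≡ 0ℚ
-[y*1/a]*a+y≡0 y a = begin
  - (y * 1/ a) * a + y   ≡⟨ regroup y (1/ a) a ⟩
  y - y * (1/ a * a)     ≡⟨ cong (λ t → y - y * t) (ℚ.*-inverseˡ a) ⟩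
  y - y * 1ℚ             ≡⟨ cong (λ t → y - t) (ℚ.*-identityʳ y) ⟩
  y - y                  ≡⟨ ℚ.+-inverseʳ y ⟩
  0ℚ                     ∎
  where
  open ≡-Reasoning
  regroup : ∀ y b a → - (y * b) * a + y ≡ y - y * (b * a)
  regroup = solve-∀ ℚ-ring

sum-zero : ∀ {n} {f : Vector ℚ n} → f ≗ const 0ℚ → sum f ≡ 0ℚ
sum-zero {n} f≗0 = trans (sum-cong-≗ f≗0) (sum-replicate-zero n)

Family : ℕ → ℕ → Set
Family m r = Vector (Vector ℚ r) m

linComb : ∀ {m r} → Vector ℚ m → Family m r → Vector ℚ r
linComb c w x = sum λ j → c j * w j x

Independent : ∀ {m r} → Family m r → Set
Independent w = ∀ c → linComb c w ≗ const 0ℚ → c ≗ const 0ℚ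

Dependent : ∀ {m r} → Family m r → Set
Dependent {m} w = ∃ λ c → linComb c w ≗ const 0ℚ × ∃ λ (j : Fin m) → c j ≢ 0ℚ

record _∈Span_ {m r} (u : Vector ℚ r) (w : Family m r) : Set where
  constructor combination
  field
    coefficients : Vector ℚ m
    ≗linComb     : u ≗ linComb coefficients w

open _∈Span_

_⊆Span_ : ∀ {k m r} → Family k r → Family m r → Set
v ⊆Span w = ∀ i → v i ∈Span w

IndependentSubfamily : ∀ {m r} → ℕ → Family m r → Set
IndependentSubfamily {m} k w = ∃ λ (g : Fin k → Fin m) → Injective _≡_ _≡_ g × Independent (w ∘ g)

HasRank : ∀ {m r} → Family m r → ℕ → Set
HasRank w k = IndependentSubfamily k w × ¬ IndependentSubfamily (suc k) w

module _ {r : ℕ} where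

  linComb-zeroˡ : ∀ {m c} (w : Family m r) → c ≗ const 0ℚ → linComb c w ≗ const 0ℚ
  linComb-zeroˡ w c≗0 x = sum-zero λ j → trans (cong (_* w j x) (c≗0 j)) (ℚ.*-zeroˡ (w j x))

  linComb-*ʳ : ∀ {m} c (w : Family m r) x k → linComb c w x * k ≡ linComb (λ j → c j * k) w x
  linComb-*ʳ c w x k = trans (*-distribʳ-sum k (λ j → c j * w j x))
                             (sum-cong-≗ λ j → swap (c j) (w j x) k)
    where
    swap : ∀ c w k → c * w * k ≡ c * k * w
    swap = solve-∀ ℚ-ring

  linComb-+ : ∀ {m} c d (w : Family m r) x → linComb (λ j → c j + d j) w x ≡ linComb c w x + linComb d w x
  linComb-+ c d w x = trans (sum-cong-≗ λ j → ℚ.*-distribʳ-+ (w j x) (c j) (d j))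
                            (∑-distrib-+ (λ j → c j * w j x) (λ j → d j * w j x))

  linComb-linComb : ∀ {k m} {v : Family k r} {w : Family m r} (M : Family k m) →
                    (∀ i → v i ≗ linComb (M i) w) → ∀ c → linComb c v ≗ linComb (linComb c M) w
  linComb-linComb {v = v} {w} M v≗Mw c x = begin
    sum (λ i → c i * v i x)
      ≡⟨ sum-cong-≗ (λ i → cong (c i *_) (v≗Mw i x)) ⟩
    sum (λ i → c i * sum (λ l → M i l * w l x))
      ≡⟨ sum-cong-≗ (λ i → *-distribˡ-sum (c i) (λ l → M i l * w l x)) ⟩
    sum (λ i → sum (λ l → c i * (M i l * w l x)))
      ≡⟨ ∑-comm (λ i l → c i * (M i l * w l x)) ⟩
    sum (λ l → sum (λ i → c i * (M i l * w l x)))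
      ≡⟨ sum-cong-≗ (λ l → sum-cong-≗ λ i → ℚ.*-assoc (c i) (M i l) (w l x)) ⟨
    sum (λ l → sum (λ i → c i * M i l * w l x))
      ≡⟨ sum-cong-≗ (λ l → *-distribʳ-sum (w l x) (λ i → c i * M i l)) ⟨
    sum (λ l → sum (λ i → c i * M i l) * w l x) ∎
    where open ≡-Reasoning

  linComb-removeAt : ∀ {m} c (w : Family (suc m) r) j x →
                     linComb c w x ≡ c j * w j x + linComb (removeAt c j) (removeAt w j) x
  linComb-removeAt c w j x = sum-remove {i = j} (λ l → c l * w l x)

  linComb-insertAt : ∀ {m} d e (w : Family (suc m) r) j x →
                     linComb (insertAt d j e) w x ≡ e * w j x + linComb d (removeAt w j) x
  linComb-insertAt d e w j x = trans (linComb-removeAt (insertAt d j e) w j x)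
    (cong₂ _+_ (cong (_* w j x) (insertAt-lookup d j e))
               (sum-cong-≗ λ l → cong (_* removeAt w j l x) (removeAt-insertAt d j e l)))

∈Span-member : ∀ {m r} {w : Family m r} j → w j ∈Span w
∈Span-member {suc m} {w = w} j = combination (insertAt (const 0ℚ) j 1ℚ) λ x → sym (begin
  linComb (insertAt (const 0ℚ) j 1ℚ) w x               ≡⟨ linComb-insertAt (const 0ℚ) 1ℚ w j x ⟩
  1ℚ * w j x + linComb (const 0ℚ) (removeAt w j) x
    ≡⟨ cong₂ _+_ (ℚ.*-identityˡ (w j x)) (linComb-zeroˡ (removeAt w j) (λ _ → refl) x) ⟩
  w j x + 0ℚ                                           ≡⟨ ℚ.+-identityʳ (w j x) ⟩
  w j x                                                ∎)
  where open ≡-Reasoning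

∈Span-resp-≗ : ∀ {m r} {u v : Vector ℚ r} {w : Family m r} → u ≗ v → u ∈Span w → v ∈Span w
∈Span-resp-≗ u≗v (combination c u≗cw) = combination c λ x → trans (sym (u≗v x)) (u≗cw x)

∈Span-+ : ∀ {m r} {u v : Vector ℚ r} {w : Family m r} →
          u ∈Span w → v ∈Span w → (λ x → u x + v x) ∈Span w
∈Span-+ {w = w} (combination c u≗cw) (combination d v≗dw) = combination (λ j → c j + d j) λ x →
  trans (cong₂ _+_ (u≗cw x) (v≗dw x)) (sym (linComb-+ c d w x))

∈Span-trans : ∀ {k m r} {u : Vector ℚ r} {v : Family k r} {w : Family m r} →
              u ∈Span v → v ⊆Span w → u ∈Span w
∈Span-trans (combination c u≗cv) v⊆w = combination (linComb c (coefficients ∘ v⊆w)) λ x →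
  trans (u≗cv x) (linComb-linComb (coefficients ∘ v⊆w) (≗linComb ∘ v⊆w) c x)

⊆Span-trans : ∀ {k l m r} {u : Family k r} {v : Family l r} {w : Family m r} →
              u ⊆Span v → v ⊆Span w → u ⊆Span w
⊆Span-trans u⊆v v⊆w i = ∈Span-trans (u⊆v i) v⊆w

relation⇒∈Span-removeAt : ∀ {m r} {c} {w : Family (suc m) r} → linComb c w ≗ const 0ℚ →
                          ∀ j → c j ≢ 0ℚ → w j ∈Span removeAt w j
relation⇒∈Span-removeAt {c = c} {w} rel j cj≢0 = combination (λ l → removeAt c j l * - (1/ c j)) λ x → begin
  w j x                          ≡⟨ x*a+y≡0⇒x≡-[y*1/a] (c j) (trans (cong (_+ R x) (ℚ.*-comm (w j x) (c j)))
                                      (trans (sym (linComb-removeAt c w j x)) (rel x))) ⟩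
  - (R x * 1/ c j)               ≡⟨ ℚ.neg-distribʳ-* (R x) (1/ c j) ⟩
  R x * - (1/ c j)               ≡⟨ linComb-*ʳ (removeAt c j) (removeAt w j) x _ ⟩
  linComb (λ l → removeAt c j l * - (1/ c j)) (removeAt w j) x ∎
  where
  open ≡-Reasoning
  instance _ = ≢-nonZero cj≢0
  R = linComb (removeAt c j) (removeAt w j)

relation⇒⊆Span-removeAt : ∀ {m r} {c} {w : Family (suc m) r} {j} → linComb c w ≗ const 0ℚ →
                           c j ≢ 0ℚ → w ⊆Span removeAt w j
relation⇒⊆Span-removeAt {c = c} {w} {j} rel cj≢0 l with l ≟ j
... | yes refl = relation⇒∈Span-removeAt {c = c} {w} rel j cj≢0
... | no l≢j   = subst (_∈Span removeAt w j) (removeAt-punchOut w (l≢j ∘ sym)) (∈Span-member _)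

module Elimination {m r} (w : Family (suc m) (suc r)) (p : Fin (suc m)) (a≢0 : w p zero ≢ 0ℚ) where

  private
    instance
      a-nonZero : NonZero (w p zero)
      a-nonZero = ≢-nonZero a≢0

    a = w p zero
    W = removeAt w p

  open ≡-Reasoning

  reduced : Family m r
  reduced l x = W l (suc x) - W l zero * 1/ a * w p (suc x)

  pivotCoefficient : Vector ℚ m → ℚ
  pivotCoefficient d = - (linComb d W zero * 1/ a)

  linComb-reduced : ∀ d x → linComb d reduced x ≡ pivotCoefficient d * w p (suc x) + linComb d W (suc x)
  linComb-reduced d x = begin
    sum (λ l → d l * (W l (suc x) - W l zero * 1/ a * w p (suc x)))
      ≡⟨ sum-cong-≗ (λ l → expand (d l) (W l (suc x)) (W l zero) (1/ a) (w p (suc x))) ⟩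
    sum (λ l → d l * W l (suc x) + d l * W l zero * - (1/ a * w p (suc x)))
      ≡⟨ ∑-distrib-+ (λ l → d l * W l (suc x)) (λ l → d l * W l zero * - (1/ a * w p (suc x))) ⟩
    linComb d W (suc x) + sum (λ l → d l * W l zero * - (1/ a * w p (suc x)))
      ≡⟨ cong (linComb d W (suc x) +_) (*-distribʳ-sum _ (λ l → d l * W l zero)) ⟨
    linComb d W (suc x) + linComb d W zero * - (1/ a * w p (suc x))
      ≡⟨ collect (linComb d W (suc x)) (linComb d W zero) (1/ a) (w p (suc x)) ⟩
    pivotCoefficient d * w p (suc x) + linComb d W (suc x) ∎
    where
    expand : ∀ d y z b q → d * (y - z * b * q) ≡ d * y + d * z * - (b * q)
    expand = solve-∀ ℚ-ring
    collect : ∀ s t b q → s + t * - (b * q) ≡ - (t * b) * q + s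
    collect = solve-∀ ℚ-ring

  independent : Independent reduced → Independent w
  independent reduced-ind c c-rel = c≗0
    where
    d = removeAt c p

    cp≡pivotCoefficient : c p ≡ pivotCoefficient d
    cp≡pivotCoefficient = x*a+y≡0⇒x≡-[y*1/a] a (trans (sym (linComb-removeAt c w p zero)) (c-rel zero))

    d≗0 : d ≗ const 0ℚ
    d≗0 = reduced-ind d λ x → begin
      linComb d reduced x                                    ≡⟨ linComb-reduced d x ⟩
      pivotCoefficient d * w p (suc x) + linComb d W (suc x)
        ≡⟨ cong (λ e → e * w p (suc x) + linComb d W (suc x)) cp≡pivotCoefficient ⟨
      c p * w p (suc x) + linComb d W (suc x)                ≡⟨ linComb-removeAt c w p (suc x) ⟨
      linComb c w (suc x)                                    ≡⟨ c-rel (suc x) ⟩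
      0ℚ                                                     ∎

    cp≡0 : c p ≡ 0ℚ
    cp≡0 = begin
      c p                          ≡⟨ cp≡pivotCoefficient ⟩
      - (linComb d W zero * 1/ a)  ≡⟨ cong (λ t → - (t * 1/ a)) (linComb-zeroˡ W d≗0 zero) ⟩
      - (0ℚ * 1/ a)                ≡⟨ cong -_ (ℚ.*-zeroˡ (1/ a)) ⟩
      0ℚ                           ∎

    c≗0 : c ≗ const 0ℚ
    c≗0 j with j ≟ p
    ... | yes refl = cp≡0
    ... | no j≢p   = trans (cong c (sym (punchIn-punchOut (j≢p ∘ sym)))) (d≗0 _)

  dependent : Dependent reduced → Dependent w
  dependent (d , d-rel , l , dl≢0) =
    insertAt d p e , rel , punchIn p l , dl≢0 ∘ trans (sym (insertAt-punchIn d p e l))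
    where
    e = pivotCoefficient d

    rel : linComb (insertAt d p e) w ≗ const 0ℚ
    rel zero    = trans (linComb-insertAt d e w p zero) (-[y*1/a]*a+y≡0 (linComb d W zero) a)
    rel (suc x) = begin
      linComb (insertAt d p e) w (suc x)   ≡⟨ linComb-insertAt d e w p (suc x) ⟩
      e * w p (suc x) + linComb d W (suc x) ≡⟨ linComb-reduced d x ⟨
      linComb d reduced x                  ≡⟨ d-rel x ⟩
      0ℚ                                   ∎

independent-or-dependent : ∀ {m r} (w : Family m r) → (m ≤ r × Independent w) ⊎ Dependent w
independent-or-dependent {zero}          w = inj₁ (z≤n , λ _ _ ())
independent-or-dependent {suc m} {zero}  w = inj₂ (const 1ℚ , (λ ()) , zero , λ ())
independent-or-dependent {suc m} {suc r} w with all? (λ j → w j zero ℚ.≟ 0ℚ)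
... | yes first≡0 = Sum.map (Product.map m≤n⇒m≤1+n independent) dependent
                            (independent-or-dependent (λ j x → w j (suc x)))
  where
  first-linComb≡0 : ∀ c → linComb c w zero ≡ 0ℚ
  first-linComb≡0 c = sum-zero λ j → trans (cong (c j *_) (first≡0 j)) (ℚ.*-zeroʳ (c j))

  independent : Independent (λ j x → w j (suc x)) → Independent w
  independent ind c rel = ind c (rel ∘ suc)

  dependent : Dependent (λ j x → w j (suc x)) → Dependent w
  dependent (c , rel , j , cj≢0) = c , (λ { zero → first-linComb≡0 c ; (suc x) → rel x }) , j , cj≢0
... | no ¬first≡0 with ¬∀⟶∃¬ _ _ (λ j → w j zero ℚ.≟ 0ℚ) ¬first≡0
...   | p , a≢0 = Sum.map (Product.map s≤s independent) dependent (independent-or-dependent reduced)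
  where open Elimination w p a≢0

independent-⊆Span⇒≤ : ∀ {k m r} {v : Family k r} {w : Family m r} → Independent v → v ⊆Span w → k ≤ m
independent-⊆Span⇒≤ {w = w} v-ind v⊆w with independent-or-dependent (coefficients ∘ v⊆w)
... | inj₁ (k≤m , _)              = k≤m
... | inj₂ (c , c-rel , j , cj≢0) = contradiction (v-ind c v-rel j) cj≢0
  where
  v-rel = λ x → trans (linComb-linComb (coefficients ∘ v⊆w) (≗linComb ∘ v⊆w) c x)
                      (linComb-zeroˡ w c-rel x)

independent-removeAt : ∀ {m r} (w : Family (suc m) r) j → Independent w → Independent (removeAt w j)
independent-removeAt w j w-ind c rel l =
  trans (sym (insertAt-punchIn c j 0ℚ l)) (w-ind (insertAt c j 0ℚ) extended-rel (punchIn j l))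
  where
  extended-rel : linComb (insertAt c j 0ℚ) w ≗ const 0ℚ
  extended-rel x = begin
    linComb (insertAt c j 0ℚ) w x               ≡⟨ linComb-insertAt c 0ℚ w j x ⟩
    0ℚ * w j x + linComb c (removeAt w j) x     ≡⟨ cong (_+ linComb c (removeAt w j) x) (ℚ.*-zeroˡ (w j x)) ⟩
    0ℚ + linComb c (removeAt w j) x             ≡⟨ ℚ.+-identityˡ _ ⟩
    linComb c (removeAt w j) x                  ≡⟨ rel x ⟩
    0ℚ                                          ∎
    where open ≡-Reasoning

independentSubfamily-≤‴ : ∀ {k l m r} {w : Family m r} →
                          k ≤‴ l → IndependentSubfamily l w → IndependentSubfamily k w
independentSubfamily-≤‴         ≤‴-refl       S = S
independentSubfamily-≤‴ {w = w} (≤‴-step k<l) S with independentSubfamily-≤‴ {w = w} k<l S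
... | g , g-inj , g-ind = g ∘ suc , suc-injective ∘ g-inj , independent-removeAt (w ∘ g) zero g-ind

independent⇒independentSubfamily : ∀ {k m r} {w : Family m r} →
                                   k ≤ m → Independent w → IndependentSubfamily k w
independent⇒independentSubfamily k≤m w-ind = independentSubfamily-≤‴ (≤⇒≤‴ k≤m) (id , id , w-ind)

-- Steinitz exchange: discard vectors of w that depend on the others until w is independent.
independent-⊆Span⇒independentSubfamily : ∀ {k m r} {v : Family k r} (w : Family m r) →
                                         Independent v → v ⊆Span w → IndependentSubfamily k w
independent-⊆Span⇒independentSubfamily w v-ind v⊆w with independent-or-dependent w
... | inj₁ (_ , w-ind) = independent⇒independentSubfamily (independent-⊆Span⇒≤ v-ind v⊆w) w-ind
independent-⊆Span⇒independentSubfamily {m = zero}  w v-ind v⊆w | inj₂ (_ , _ , () , _)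
independent-⊆Span⇒independentSubfamily {m = suc m} w v-ind v⊆w | inj₂ (c , c-rel , j , cj≢0)
  with independent-⊆Span⇒independentSubfamily (removeAt w j) v-ind
         (⊆Span-trans v⊆w (relation⇒⊆Span-removeAt {c = c} {w} c-rel cj≢0))
... | g , g-inj , g-ind = punchIn j ∘ g , g-inj ∘ punchIn-injective j _ _ , g-ind

independentSubfamily-⊆Span : ∀ {k m n r} {v : Family n r} {w : Family m r} →
                             v ⊆Span w → IndependentSubfamily k v → IndependentSubfamily k w
independentSubfamily-⊆Span {w = w} v⊆w (g , _ , g-ind) =
  independent-⊆Span⇒independentSubfamily w g-ind (v⊆w ∘ g)

hasRank-⊆Span : ∀ {k m n r} {v : Family n r} {w : Family m r} →
                v ⊆Span w → w ⊆Span v → HasRank v k → HasRank w k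
hasRank-⊆Span v⊆w w⊆v (S , ¬S′) =
  independentSubfamily-⊆Span v⊆w S , ¬S′ ∘ independentSubfamily-⊆Span w⊆v

toℚᵘ-toℚ : ∀ z → ℚ.toℚᵘ (toℚ z) ≃ᵘ mkℚᵘ z 0
toℚᵘ-toℚ z = ℚ.toℚᵘ-fromℚᵘ (mkℚᵘ z 0)

toℚ-injective : ∀ {x y} → toℚ x ≡ toℚ y → x ≡ y
toℚ-injective {x} {y} eq = begin
  x           ≡⟨ ℤ.*-identityʳ x ⟨
  x ℤ.* ℤ.1ℤ  ≡⟨ ℚᵘ.drop-*≡* mkℚᵘx≃mkℚᵘy ⟩
  y ℤ.* ℤ.1ℤ  ≡⟨ ℤ.*-identityʳ y ⟩
  y           ∎
  where
  open ≡-Reasoning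
  mkℚᵘx≃mkℚᵘy : mkℚᵘ x 0 ≃ᵘ mkℚᵘ y 0
  mkℚᵘx≃mkℚᵘy = ℚᵘ.≃-trans (ℚᵘ.≃-sym (toℚᵘ-toℚ x)) (ℚᵘ.≃-trans (ℚ.toℚᵘ-cong eq) (toℚᵘ-toℚ y))

toℚ-+ : ∀ x y → toℚ (x ℤ.+ y) ≡ toℚ x + toℚ y
toℚ-+ x y = ℚ.toℚᵘ-injective (begin
  ℚ.toℚᵘ (toℚ (x ℤ.+ y))                   ≈⟨ toℚᵘ-toℚ (x ℤ.+ y) ⟩
  mkℚᵘ (x ℤ.+ y) 0                         ≈⟨ *≡* integral ⟩
  mkℚᵘ x 0 ℚᵘ.+ mkℚᵘ y 0                   ≈⟨ ℚᵘ.+-cong (toℚᵘ-toℚ x) (toℚᵘ-toℚ y) ⟨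
  ℚ.toℚᵘ (toℚ x) ℚᵘ.+ ℚ.toℚᵘ (toℚ y)       ≈⟨ ℚ.toℚᵘ-homo-+ (toℚ x) (toℚ y) ⟨
  ℚ.toℚᵘ (toℚ x + toℚ y)                   ∎)
  where
  open ℚᵘ.≃-Reasoning
  integral : (x ℤ.+ y) ℤ.* ℤ.1ℤ ≡ (x ℤ.* ℤ.1ℤ ℤ.+ y ℤ.* ℤ.1ℤ) ℤ.* ℤ.1ℤ
  integral = cong (ℤ._* ℤ.1ℤ) (sym (cong₂ ℤ._+_ (ℤ.*-identityʳ x) (ℤ.*-identityʳ y)))

toℚ-* : ∀ x y → toℚ (x ℤ.* y) ≡ toℚ x * toℚ y
toℚ-* x y = ℚ.toℚᵘ-injective (begin
  ℚ.toℚᵘ (toℚ (x ℤ.* y))                   ≈⟨ toℚᵘ-toℚ (x ℤ.* y) ⟩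
  mkℚᵘ x 0 ℚᵘ.* mkℚᵘ y 0                   ≈⟨ ℚᵘ.*-cong (toℚᵘ-toℚ x) (toℚᵘ-toℚ y) ⟨
  ℚ.toℚᵘ (toℚ x) ℚᵘ.* ℚ.toℚᵘ (toℚ y)       ≈⟨ ℚ.toℚᵘ-homo-* (toℚ x) (toℚ y) ⟨
  ℚ.toℚᵘ (toℚ x * toℚ y)                   ∎)
  where open ℚᵘ.≃-Reasoning

toℚ-Σℤ : ∀ {n} (f : Fin n → ℤ) → toℚ (Σℤ f) ≡ sum (toℚ ∘ f)
toℚ-Σℤ {zero}  f = refl
toℚ-Σℤ {suc n} f = trans (toℚ-+ (f zero) (Σℤ (f ∘ suc))) (cong (toℚ (f zero) +_) (toℚ-Σℤ (f ∘ suc)))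

Σℚ≡sum : ∀ {n} (f : Fin n → ℚ) → Σℚ f ≡ sum f
Σℚ≡sum {zero}  f = refl
Σℚ≡sum {suc n} f = cong (f zero +_) (Σℚ≡sum (f ∘ suc))

columns : ∀ {r n} → Matrix r n → Family n r
columns A j i = toℚ (A i j)

module _ {r n : ℕ} (A : Matrix r n) where

  columnsIndependent⇔independent : ∀ {k} (f : Fin k → Fin n) →
                                   ColumnsIndependent A f ⇔ Independent (columns A ∘ f)
  columnsIndependent⇔independent f = mk⇔
    (λ ind c rel → ind c λ i → trans (Σℚ≡sum (λ j → c j * toℚ (A i (f j)))) (rel i))
    (λ ind c rel → ind c λ i → trans (sym (Σℚ≡sum (λ j → c j * toℚ (A i (f j))))) (rel i))

  isRank⇔hasRank : ∀ k → IsRank A k ⇔ HasRank (columns A) k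
  isRank⇔hasRank k = mk⇔
    (λ ((f , f-inj , f-ind) , maximal) →
       (f , f-inj , to f f-ind) , λ (g , g-inj , g-ind) → maximal g g-inj (from g g-ind))
    (λ ((f , f-inj , f-ind) , maximal) →
       (f , f-inj , from f f-ind) , λ g g-inj g-ind → maximal (g , g-inj , to g g-ind))
    where
    to : ∀ {k} (f : Fin k → Fin n) → ColumnsIndependent A f → Independent (columns A ∘ f)
    to f = Equivalence.to (columnsIndependent⇔independent f)
    from : ∀ {k} (f : Fin k → Fin n) → Independent (columns A ∘ f) → ColumnsIndependent A f
    from f = Equivalence.from (columnsIndependent⇔independent f)

  positiveSolution⇒relation : HasPositiveSolution A →
                              ∃ λ c → linComb c (columns A) ≗ const 0ℚ × (∀ j → c j ≢ 0ℚ)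
  positiveSolution⇒relation (α , α>0 , Aα≡0) =
    toℚ ∘ α , rel , λ j → ℤ.<⇒≢ (α>0 j) ∘ sym ∘ toℚ-injective
    where
    rel : linComb (toℚ ∘ α) (columns A) ≗ const 0ℚ
    rel i = begin
      sum (λ j → toℚ (α j) * toℚ (A i j))
        ≡⟨ sum-cong-≗ (λ j → trans (ℚ.*-comm (toℚ (α j)) (toℚ (A i j))) (sym (toℚ-* (A i j) (α j)))) ⟩
      sum (λ j → toℚ (A i j ℤ.* α j))      ≡⟨ toℚ-Σℤ (λ j → A i j ℤ.* α j) ⟨
      toℚ (Σℤ λ j → A i j ℤ.* α j)         ≡⟨ cong toℚ (Aα≡0 i) ⟩
      0ℚ                                   ∎
      where open ≡-Reasoning

isRank-⊆Span : ∀ {r m n k} (A : Matrix r m) (B : Matrix r n) →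
               columns A ⊆Span columns B → columns B ⊆Span columns A → IsRank A k → IsRank B k
isRank-⊆Span A B A⊆B B⊆A =
  Equivalence.from (isRank⇔hasRank B _) ∘ hasRank-⊆Span A⊆B B⊆A ∘ Equivalence.to (isRank⇔hasRank A _)

positiveSolution⇒∈Span-removeAt : ∀ {r n} (A : Matrix r (suc n)) → HasPositiveSolution A →
                                  ∀ j → columns A j ∈Span removeAt (columns A) j
positiveSolution⇒∈Span-removeAt A E j with c , rel , c≢0 ← positiveSolution⇒relation A E =
  relation⇒∈Span-removeAt {c = c} {columns A} rel j (c≢0 j)

module _ {r m : ℕ} (A : Matrix r (suc (suc m))) where

  columns-A₃-⊆Span : columns (A₃ A) ⊆Span columns A
  columns-A₃-⊆Span zero    = ∈Span-resp-≗ (λ i → sym (toℚ-+ (A i zero) (A i (suc zero))))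
                                          (∈Span-+ (∈Span-member zero) (∈Span-member (suc zero)))
  columns-A₃-⊆Span (suc j) = ∈Span-member (suc (suc j))

  -- Deleting column 1 of A₁, or column 2 of A₂, leaves exactly the columns of A₃.
  columns-⊆Span-A₃ : HasPositiveSolution (A₁ A) → HasPositiveSolution (A₂ A) → columns A ⊆Span columns (A₃ A)
  columns-⊆Span-A₃ E₁ _ zero =
    ∈Span-trans (positiveSolution⇒∈Span-removeAt (A₁ A) E₁ zero)
                λ { zero → ∈Span-member zero ; (suc j) → ∈Span-member (suc j) }
  columns-⊆Span-A₃ _ E₂ (suc zero) =
    ∈Span-trans (positiveSolution⇒∈Span-removeAt (A₂ A) E₂ (suc zero))
                λ { zero → ∈Span-member zero ; (suc j) → ∈Span-member (suc j) }
  columns-⊆Span-A₃ _ _ (suc (suc j)) = ∈Span-member (suc j)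

lemma6p2 : ∀ {r m : ℕ} (A : Matrix (suc r) (suc (suc m))) →
    0ℤ < A zero zero → A zero (suc zero) < 0ℤ →
    HasPositiveSolution (A₁ A) → HasPositiveSolution (A₂ A) → HasPositiveSolution (A₃ A) →
    ∀ (k : ℕ) → (IsRank A k → IsRank (A₃ A) k) × (IsRank (A₃ A) k → IsRank A k)
lemma6p2 A _ _ E₁ E₂ _ k = isRank-⊆Span A (A₃ A) A⊆A₃ A₃⊆A , isRank-⊆Span (A₃ A) A A₃⊆A A⊆A₃
  where
  A⊆A₃ = columns-⊆Span-A₃ A E₁ E₂
  A₃⊆A = columns-A₃-⊆Span A
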